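{- Let $Q_0(z,u),Q_1(z,u),Q_2(z,u),Q_3(z,u)$ be polynomials with non-negative coefficients and consider the linear catalytic equation \[ M(z,u)=zQ_0(z,u)+zQ_1(z,u)M(z,u)+zQ_2(z,u)\Delta M(z,u)+zQ_3(z,u)\Delta^{(2)}M(z,u), \] with $M(z,u)=\sum_{i\ge0}M_i(z)u^i$, $\Delta M=(M-M_0)/u$, $\Delta^{(2)}M=(M-M_0-uM_1)/u^2$, viewed as the infinite system $M_i(z)=[u^i](\text{right-hand side})$, $i\ge0$. The dependency graph of this system is strongly connected if and only if $\frac{\partial}{\partial u}Q_1(z,u)\neq 0$, the curve equation $u^2=z\bigl(u^2Q_1(z,u)+uQ_2(z,u)+Q_3(z,u)\bigr)$ is not a polynomial in $u^2$, and $u$ does not divide $Q_2(z,u)+Q_3(z,u)$.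
   Context: The dependency graph of the infinite system is the digraph on $\{M_0,M_1,\dots\}$ with an edge $(M_i,M_j)$ iff the right-hand side of the equation for $M_j$ depends on $M_i$. "The curve equation is not a polynomial in $u^2$" means the polynomial $z(u^2Q_1+uQ_2+Q_3)$ is not a polynomial in $z$ and $u^2$.
   Formalization: The polynomials $Q_0(z,u),Q_1(z,u),Q_2(z,u),Q_3(z,u)$ have non-negative rational coefficients. -}

module Defs where

open import Data.Nat as ℕ using (ℕ; zero; suc; _∸_; _≤_)
open import Data.Nat.Properties using (_≤?_; _≟_)
open import Data.Integer using (+_)
open import Data.Rational as ℚ using (ℚ; 0ℚ; 1ℚ; _/_)
open import Data.List using (List; foldr; map; upTo)
open import Data.Sum using (_⊎_)
open import Data.Product using (Σ; ∃)
open import Relation.Nullary using (¬_; yes; no)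
open import Relation.Binary.PropositionalEquality using (_≡_)
open import Relation.Binary.Construct.Closure.ReflexiveTransitive using (Star)

-- Bivariate formal power series in z and u with rational coefficients:
-- s a b is the coefficient of z^a u^b.
Series : Set
Series = ℕ → ℕ → ℚ

record Poly : Set where
  field
    coeff  : Series
    bound  : ℕ
    vanish : ∀ a b → bound ≤ a ⊎ bound ≤ b → coeff a b ≡ 0ℚ
open Poly public

NonNegCoeffs : Poly → Set
NonNegCoeffs P = ∀ a b → 0ℚ ℚ.≤ coeff P a b

sumTo : ℕ → (ℕ → ℚ) → ℚ
sumTo n f = foldr ℚ._+_ 0ℚ (map f (upTo n))

_⊕_ : Series → Series → Series
(f ⊕ g) a b = f a b ℚ.+ g a b

_⊛_ : Series → Series → Series
(f ⊛ g) a b = sumTo (suc a) λ a' → sumTo (suc b) λ b' →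
  f a' b' ℚ.* g (a ∸ a') (b ∸ b')

zmul : Series → Series
zmul f zero    b = 0ℚ
zmul f (suc a) b = f a b

umul : ℕ → Series → Series
umul k f a b with k ≤? b
... | yes _ = f a (b ∸ k)
... | no  _ = 0ℚ

-- Δ M = (M - M(z,0)) / u   and   Δ² M = (M - M_0 - u M_1) / u²
Δ : Series → Series
Δ f a b = f a (suc b)

Δ² : Series → Series
Δ² f a b = f a (suc (suc b))

-- the series u^i  (i.e. M_i = 1, all other M_k = 0)
uPow : ℕ → Series
uPow i zero b with b ≟ i
... | yes _ = 1ℚ
... | no  _ = 0ℚ
uPow i (suc a) b = 0ℚ

∂u : Series → Series
∂u f a b = ((+ suc b) / 1) ℚ.* f a (suc b)

IsZero : Series → Set
IsZero f = ∀ a b → f a b ≡ 0ℚ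

linPart : Poly → Poly → Poly → Series → Series
linPart Q1 Q2 Q3 M =
  zmul ((coeff Q1 ⊛ M) ⊕ ((coeff Q2 ⊛ Δ M) ⊕ (coeff Q3 ⊛ Δ² M)))

-- Edge (M_i, M_j): the equation M_j = [u^j](RHS) depends on M_i, i.e. the
-- coefficient of M_i in [u^j] RHS (a polynomial in z) is nonzero.
-- Since the RHS is affine in M, this coefficient is [u^j] L(u^i).
DepEdge : Poly → Poly → Poly → ℕ → ℕ → Set
DepEdge Q1 Q2 Q3 i j = ¬ (∀ a → linPart Q1 Q2 Q3 (uPow i) a j ≡ 0ℚ)

StronglyConnected : (ℕ → ℕ → Set) → Set
StronglyConnected E = ∀ i j → Star E i j

curvePoly : Poly → Poly → Poly → Series
curvePoly Q1 Q2 Q3 =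
  zmul ((umul 2 (coeff Q1) ⊕ umul 1 (coeff Q2)) ⊕ coeff Q3)

EvenInU : Series → Set
EvenInU f = ∀ a b → f a (suc (2 ℕ.* b)) ≡ 0ℚ

UDivides : Series → Set
UDivides f = Σ Poly λ g → ∀ a b → f a b ≡ umul 1 (coeff g) a b

module Submission where

-- Since all coefficients are nonnegative, nothing cancels in the right-hand side, so the
-- equation for M_j involves M_i exactly when some monomial z^a u^k of Q_(d+1) has
-- i + k = j + d (with d = 0, 1, 2 the order of Δ applied to M, and i ≥ d).  Each edge is
-- therefore a shift by k − d for a u-exponent k of Q_(d+1).
--   If Q1 has no positive u-exponent, no edge leaves M_0 upwards.  If the curve is even in
-- u, every shift is even and parity is invariant.  If u divides Q2 + Q3, no edge enters
-- M_0 from above.  Conversely, a positive u-exponent of Q1 gives a shift upwards, a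
-- constant term of Q2 or Q3 gives paths M_(i+2) →* M_i, and an odd monomial of the
-- curve gives a shift of odd length from every M_(i+2).  Two upward shifts followed by an
-- odd one and enough steps down lead from M_x to M_(x+1), and then M_(x+1) → M_(x+2) →* M_x.

open import Defs
open import Data.Bool as Bool using (Bool; true; not)
open import Data.Bool.Properties using (not-involutive)
import Data.Integer as ℤ
open import Data.List using (foldr; upTo)
open import Data.List.Properties using (map-applyUpTo; map-upTo; map-cong)
open import Data.Nat using (ℕ; zero; suc; _+_; _*_; _∸_; _≤_; _<_; _⊔_; z<s; s≤s; _≤?_; _<?_; _≟_)
import Data.Nat.Properties as ℕP
import Data.Nat.Coprimality as Coprimality
open import Data.Nat.Tactic.RingSolver using (solve-∀)
open import Data.Product using (∃; ∃₂; _×_; _,_; proj₁; proj₂)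
open import Data.Rational as ℚ using (ℚ; 0ℚ; 1ℚ; _/_; mkℚ)
import Data.Rational.Properties as ℚP
open import Data.Sum as Sum using (_⊎_; inj₁; inj₂)
open import Function.Base using (_∘_)
open import Function.Bundles using (_⇔_; mk⇔; Equivalence)
open import Relation.Binary.Construct.Closure.ReflexiveTransitive using (Star; ε; _◅_; _◅◅_; fold)
open import Relation.Binary.PropositionalEquality
open import Relation.Nullary using (¬_; Dec; yes; no; ¬?; contradiction)
open import Relation.Nullary.Decidable using (map′; decidable-stable)
open import Relation.Unary using (Decidable)

open ≡-Reasoning

NonNegSeries : Series → Set
NonNegSeries f = ∀ a b → 0ℚ ℚ.≤ f a b

+-nonNeg : ∀ {p q} → 0ℚ ℚ.≤ p → 0ℚ ℚ.≤ q → 0ℚ ℚ.≤ p ℚ.+ q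
+-nonNeg = ℚP.+-mono-≤

*-nonNeg : ∀ {p q} → 0ℚ ℚ.≤ p → 0ℚ ℚ.≤ q → 0ℚ ℚ.≤ p ℚ.* q
*-nonNeg {p} {q} 0≤p 0≤q = ℚP.nonNegative⁻¹ (p ℚ.* q)
  {{ℚP.nonNeg*nonNeg⇒nonNeg p {{ℚ.nonNegative 0≤p}} q {{ℚ.nonNegative 0≤q}}}}

nonNeg-+-≡0 : ∀ {p q} → 0ℚ ℚ.≤ p → 0ℚ ℚ.≤ q → p ℚ.+ q ≡ 0ℚ → p ≡ 0ℚ × q ≡ 0ℚ
nonNeg-+-≡0 {p} {q} 0≤p 0≤q p+q≡0 =
  ≤0 0≤p 0≤q p+q≡0 , ≤0 0≤q 0≤p (trans (ℚP.+-comm q p) p+q≡0)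
  where
  ≤0 : ∀ {x y} → 0ℚ ℚ.≤ x → 0ℚ ℚ.≤ y → x ℚ.+ y ≡ 0ℚ → x ≡ 0ℚ
  ≤0 {x} 0≤x 0≤y x+y≡0 =
    ℚP.≤-antisym (subst₂ ℚ._≤_ (ℚP.+-identityʳ x) x+y≡0 (ℚP.+-monoʳ-≤ x 0≤y)) 0≤x

suc-*-≡0 : ∀ n {p} → ((ℤ.+ suc n) / 1) ℚ.* p ≡ 0ℚ → p ≡ 0ℚ
suc-*-≡0 n {p} [1+n]p≡0 = begin
  p                                   ≡⟨ ℚP.*-identityˡ p ⟨
  1ℚ ℚ.* p                            ≡⟨ cong (ℚ._* p) (ℚP.*-inverseˡ c) ⟨
  (ℚ.1/ c ℚ.* c) ℚ.* p                ≡⟨ ℚP.*-assoc (ℚ.1/ c) c p ⟩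
  ℚ.1/ c ℚ.* (c ℚ.* p)                ≡⟨ cong (λ x → ℚ.1/ c ℚ.* (x ℚ.* p)) (ℚP.normalize-coprime coprime) ⟨
  ℚ.1/ c ℚ.* (((ℤ.+ suc n) / 1) ℚ.* p)  ≡⟨ cong (ℚ.1/ c ℚ.*_) [1+n]p≡0 ⟩
  ℚ.1/ c ℚ.* 0ℚ                       ≡⟨ ℚP.*-zeroʳ (ℚ.1/ c) ⟩
  0ℚ                                  ∎
  where
  coprime : Coprimality.Coprime (suc n) 1
  coprime = Coprimality.sym (Coprimality.1-coprimeTo (suc n))
  c : ℚ
  c = mkℚ (ℤ.+ suc n) 0 coprime

IsZero-∂u⇔IsZero-Δ : ∀ {f} → IsZero (∂u f) ⇔ IsZero (Δ f)
IsZero-∂u⇔IsZero-Δ {f} = mk⇔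
  (λ ∂f≡0 a b → suc-*-≡0 b (∂f≡0 a b))
  (λ Δf≡0 a b → trans (cong (((ℤ.+ suc b) / 1) ℚ.*_) (Δf≡0 a b)) (ℚP.*-zeroʳ ((ℤ.+ suc b) / 1)))

sumTo-suc : ∀ n f → sumTo (suc n) f ≡ f 0 ℚ.+ sumTo n (f ∘ suc)
sumTo-suc n f = cong (λ xs → f 0 ℚ.+ foldr ℚ._+_ 0ℚ xs)
  (trans (map-applyUpTo suc f n) (sym (map-upTo (f ∘ suc) n)))

sumTo-cong : ∀ n {f g : ℕ → ℚ} → (∀ k → f k ≡ g k) → sumTo n f ≡ sumTo n g
sumTo-cong n f≗g = cong (foldr ℚ._+_ 0ℚ) (map-cong f≗g (upTo n))

sumTo-zero : ∀ n {f} → (∀ {k} → k < n → f k ≡ 0ℚ) → sumTo n f ≡ 0ℚ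
sumTo-zero zero    _   = refl
sumTo-zero (suc n) {f} f≡0 = begin
  sumTo (suc n) f          ≡⟨ sumTo-suc n f ⟩
  f 0 ℚ.+ sumTo n (f ∘ suc) ≡⟨ cong₂ ℚ._+_ (f≡0 z<s) (sumTo-zero n (f≡0 ∘ s≤s)) ⟩
  0ℚ                       ∎

sumTo-single : ∀ {n f k} → k < n → (∀ {m} → m < n → m ≢ k → f m ≡ 0ℚ) → sumTo n f ≡ f k
sumTo-single {suc n} {f} {zero} _ others = begin
  sumTo (suc n) f           ≡⟨ sumTo-suc n f ⟩
  f 0 ℚ.+ sumTo n (f ∘ suc) ≡⟨ cong (f 0 ℚ.+_) (sumTo-zero n λ m<n → others (s≤s m<n) λ ()) ⟩
  f 0 ℚ.+ 0ℚ                ≡⟨ ℚP.+-identityʳ (f 0) ⟩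
  f 0                       ∎
sumTo-single {suc n} {f} {suc k} (s≤s k<n) others = begin
  sumTo (suc n) f           ≡⟨ sumTo-suc n f ⟩
  f 0 ℚ.+ sumTo n (f ∘ suc) ≡⟨ cong₂ ℚ._+_ (others z<s λ ())
                                 (sumTo-single k<n λ m<n m≢k → others (s≤s m<n) (m≢k ∘ ℕP.suc-injective)) ⟩
  0ℚ ℚ.+ f (suc k)          ≡⟨ ℚP.+-identityˡ (f (suc k)) ⟩
  f (suc k)                 ∎

sumTo-nonNeg : ∀ n {f} → (∀ k → 0ℚ ℚ.≤ f k) → 0ℚ ℚ.≤ sumTo n f
sumTo-nonNeg zero    _      = ℚP.≤-refl
sumTo-nonNeg (suc n) {f} f≥0 =
  subst (0ℚ ℚ.≤_) (sym (sumTo-suc n f)) (+-nonNeg (f≥0 0) (sumTo-nonNeg n (f≥0 ∘ suc)))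

uPow-diag : ∀ i → uPow i 0 i ≡ 1ℚ
uPow-diag i with i ≟ i
... | yes _   = refl
... | no  i≢i = contradiction refl i≢i

uPow-off : ∀ {i b} → b ≢ i → uPow i 0 b ≡ 0ℚ
uPow-off {i} {b} b≢i with b ≟ i
... | yes b≡i = contradiction b≡i b≢i
... | no  _   = refl

uPow-nonNeg : ∀ i → NonNegSeries (uPow i)
uPow-nonNeg i zero b with b ≟ i
... | yes _ = ℚP.nonNegative⁻¹ 1ℚ
... | no  _ = ℚP.≤-refl
uPow-nonNeg i (suc a) b = ℚP.≤-refl

umul-hit : ∀ {i k j} f a → i + k ≡ j → umul i f a j ≡ f a k
umul-hit {i} {k} f a refl with i ≤? i + k
... | yes _      = cong (f a) (ℕP.m+n∸m≡n i k)
... | no  i≰i+k = contradiction (ℕP.m≤m+n i k) i≰i+k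

umul-vanishes : ∀ {i j} f a → (∀ {k} → i + k ≡ j → f a k ≡ 0ℚ) → umul i f a j ≡ 0ℚ
umul-vanishes {i} {j} f a f≡0 with i ≤? j
... | yes i≤j = f≡0 (ℕP.m+[n∸m]≡n i≤j)
... | no  _   = refl

umul-nonzero : ∀ {i j} f a → umul i f a j ≢ 0ℚ → ∃ λ k → i + k ≡ j × f a k ≢ 0ℚ
umul-nonzero {i} {j} f a ≢0 with i ≤? j
... | yes i≤j = j ∸ i , ℕP.m+[n∸m]≡n i≤j , ≢0
... | no  _   = contradiction refl ≢0

umul-nonNeg : ∀ i {f} → NonNegSeries f → NonNegSeries (umul i f)
umul-nonNeg i f≥0 a b with i ≤? b
... | yes _ = f≥0 a (b ∸ i)
... | no  _ = ℚP.≤-refl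

-- Δ and Δ² are Δ^ 1 and Δ^ 2 up to definitional equality.
Δ^ : ℕ → Series → Series
Δ^ d f a b = f a (d + b)

Δ^-uPow : ∀ d i a b → Δ^ d (uPow (d + i)) a b ≡ uPow i a b
Δ^-uPow d i zero b with b ≟ i
... | yes refl = uPow-diag (d + b)
... | no  b≢i  = uPow-off (b≢i ∘ ℕP.+-cancelˡ-≡ d b i)
Δ^-uPow d i (suc a) b = refl

Δ^-uPow-< : ∀ {d i} → i < d → ∀ a b → Δ^ d (uPow i) a b ≡ 0ℚ
Δ^-uPow-< {d} i<d zero b = uPow-off λ d+b≡i → ℕP.<⇒≱ i<d (subst (d ≤_) d+b≡i (ℕP.m≤m+n d b))
Δ^-uPow-< _ (suc a) b = refl

⊛-congʳ : ∀ f {g h} → (∀ a b → g a b ≡ h a b) → ∀ a b → (f ⊛ g) a b ≡ (f ⊛ h) a b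
⊛-congʳ f g≗h a b = sumTo-cong (suc a) λ a′ → sumTo-cong (suc b) λ b′ →
  cong (f a′ b′ ℚ.*_) (g≗h (a ∸ a′) (b ∸ b′))

⊛-zeroʳ : ∀ f {g} → (∀ a b → g a b ≡ 0ℚ) → ∀ a b → (f ⊛ g) a b ≡ 0ℚ
⊛-zeroʳ f g≡0 a b = sumTo-zero (suc a) λ {a′} _ → sumTo-zero (suc b) λ {b′} _ →
  trans (cong (f a′ b′ ℚ.*_) (g≡0 (a ∸ a′) (b ∸ b′))) (ℚP.*-zeroʳ (f a′ b′))

⊛-nonNeg : ∀ {f g} → NonNegSeries f → NonNegSeries g → NonNegSeries (f ⊛ g)
⊛-nonNeg f≥0 g≥0 a b = sumTo-nonNeg (suc a) λ a′ → sumTo-nonNeg (suc b) λ b′ →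
  *-nonNeg (f≥0 a′ b′) (g≥0 (a ∸ a′) (b ∸ b′))

row-⊛-uPow : ∀ f i a b → sumTo (suc b) (λ b′ → f a b′ ℚ.* uPow i 0 (b ∸ b′)) ≡ umul i f a b
row-⊛-uPow f i a b with i ≤? b
... | yes i≤b = begin
  sumTo (suc b) (λ b′ → f a b′ ℚ.* uPow i 0 (b ∸ b′))
    ≡⟨ sumTo-single (s≤s (ℕP.m∸n≤m b i)) off-diagonal ⟩
  f a (b ∸ i) ℚ.* uPow i 0 (b ∸ (b ∸ i))
    ≡⟨ cong (λ c → f a (b ∸ i) ℚ.* uPow i 0 c) (ℕP.m∸[m∸n]≡n i≤b) ⟩
  f a (b ∸ i) ℚ.* uPow i 0 i
    ≡⟨ cong (f a (b ∸ i) ℚ.*_) (uPow-diag i) ⟩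
  f a (b ∸ i) ℚ.* 1ℚ
    ≡⟨ ℚP.*-identityʳ (f a (b ∸ i)) ⟩
  f a (b ∸ i) ∎
  where
  off-diagonal : ∀ {m} → m < suc b → m ≢ b ∸ i → f a m ℚ.* uPow i 0 (b ∸ m) ≡ 0ℚ
  off-diagonal {m} m<1+b m≢b∸i = trans (cong (f a m ℚ.*_) (uPow-off {i} {b ∸ m} λ b∸m≡i →
    m≢b∸i (trans (sym (ℕP.m∸[m∸n]≡n {b} {m} (ℕP.≤-pred m<1+b))) (cong (b ∸_) b∸m≡i))))
    (ℚP.*-zeroʳ (f a m))
... | no i≰b = sumTo-zero (suc b) λ {m} _ → trans (cong (f a m ℚ.*_) (uPow-off {i} {b ∸ m} λ b∸m≡i →
  i≰b (subst (_≤ b) b∸m≡i (ℕP.m∸n≤m b m)))) (ℚP.*-zeroʳ (f a m))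

⊛-uPow : ∀ f i a b → (f ⊛ uPow i) a b ≡ umul i f a b
⊛-uPow f i a b = begin
  (f ⊛ uPow i) a b
    ≡⟨ sumTo-single (ℕP.n<1+n a) other-rows ⟩
  sumTo (suc b) (λ b′ → f a b′ ℚ.* uPow i (a ∸ a) (b ∸ b′))
    ≡⟨ cong (λ c → sumTo (suc b) λ b′ → f a b′ ℚ.* uPow i c (b ∸ b′)) (ℕP.n∸n≡0 a) ⟩
  sumTo (suc b) (λ b′ → f a b′ ℚ.* uPow i 0 (b ∸ b′))
    ≡⟨ row-⊛-uPow f i a b ⟩
  umul i f a b ∎
  where
  other-rows : ∀ {a′} → a′ < suc a → a′ ≢ a →
    sumTo (suc b) (λ b′ → f a′ b′ ℚ.* uPow i (a ∸ a′) (b ∸ b′)) ≡ 0ℚ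
  other-rows {a′} a′<1+a a′≢a with a ∸ a′ | ℕP.m<n⇒0<n∸m (ℕP.≤∧≢⇒< (ℕP.≤-pred a′<1+a) a′≢a)
  ... | suc _ | _ = sumTo-zero (suc b) λ {b′} _ → ℚP.*-zeroʳ (f a′ b′)

-- Bounded series, decided by finite search

Bounded : ℕ → Series → Set
Bounded B f = ∀ a b → B ≤ a ⊎ B ≤ b → f a b ≡ 0ℚ

Bounded-mono : ∀ {B C f} → B ≤ C → Bounded B f → Bounded C f
Bounded-mono B≤C f-bounded a b outside =
  f-bounded a b (Sum.map (ℕP.≤-trans B≤C) (ℕP.≤-trans B≤C) outside)

Bounded-⊕ : ∀ {B C f g} → Bounded B f → Bounded C g → Bounded (B ⊔ C) (f ⊕ g)
Bounded-⊕ {B} {C} f-bounded g-bounded a b outside =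
  cong₂ ℚ._+_ (Bounded-mono (ℕP.m≤m⊔n B C) f-bounded a b outside)
              (Bounded-mono (ℕP.m≤n⊔m B C) g-bounded a b outside)

Bounded-umul : ∀ {B f} k → Bounded B f → Bounded (k + B) (umul k f)
Bounded-umul {B} k f-bounded a b outside with k ≤? b
... | yes _ = f-bounded a (b ∸ k) (Sum.map (ℕP.≤-trans (ℕP.m≤n+m B k))
  (λ k+B≤b → subst (_≤ b ∸ k) (ℕP.m+n∸m≡n k B) (ℕP.∸-monoˡ-≤ k k+B≤b)) outside)
... | no  _ = refl

Bounded-zmul : ∀ {B f} → Bounded B f → Bounded (suc B) (zmul f)
Bounded-zmul f-bounded zero    b _       = refl
Bounded-zmul f-bounded (suc a) b outside = f-bounded a b (Sum.map ℕP.≤-pred ℕP.<⇒≤ outside)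

Bounded-reindex : ∀ {B f} (σ : ℕ → ℕ) → (∀ b → b ≤ σ b) → Bounded B f → Bounded B (λ a b → f a (σ b))
Bounded-reindex σ b≤σb f-bounded a b outside =
  f-bounded a (σ b) (Sum.map₂ (λ B≤b → ℕP.≤-trans B≤b (b≤σb b)) outside)

module _ {P : ℕ → Set} (P? : Decidable P) {B : ℕ} (P-beyond : ∀ {n} → B ≤ n → P n) where

  private
    ∀-from-below : (∀ {n} → n < B → P n) → ∀ n → P n
    ∀-from-below P-below n with n <? B
    ... | yes n<B = P-below n<B
    ... | no  n≮B = P-beyond (ℕP.≮⇒≥ n≮B)

  ∀?-bounded : Dec (∀ n → P n)
  ∀?-bounded = map′ ∀-from-below (λ ∀P {n} _ → ∀P n) (ℕP.allUpTo? P? B)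

  ¬∀⇒∃¬-bounded : ¬ (∀ n → P n) → ∃ λ n → ¬ P n
  ¬∀⇒∃¬-bounded ¬∀P with ℕP.anyUpTo? (¬? ∘ P?) B
  ... | yes (n , _ , ¬Pn) = n , ¬Pn
  ... | no  ∄¬P = contradiction
    (∀-from-below λ {n} n<B → decidable-stable (P? n) λ ¬Pn → ∄¬P (n , n<B , ¬Pn)) ¬∀P

nonzero-coefficient : ∀ {B f} → Bounded B f → ¬ IsZero f → ∃₂ λ a b → f a b ≢ 0ℚ
nonzero-coefficient {B} {f} f-bounded f≢0 =
  let a , row≢0 = ¬∀⇒∃¬-bounded row≡0? (λ {a} B≤a b → f-bounded a b (inj₁ B≤a)) f≢0
      b , fab≢0 = ¬∀⇒∃¬-bounded (λ b → f a b ℚ.≟ 0ℚ) (λ {b} B≤b → f-bounded a b (inj₂ B≤b)) row≢0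
  in a , b , fab≢0
  where
  row≡0? : Decidable (λ a → ∀ b → f a b ≡ 0ℚ)
  row≡0? a = ∀?-bounded (λ b → f a b ℚ.≟ 0ℚ) (λ {b} B≤b → f-bounded a b (inj₂ B≤b))

UDivides-intro : ∀ {B f} → Bounded B f → (∀ a → f a 0 ≡ 0ℚ) → UDivides f
UDivides-intro {B} {f} f-bounded f₀≡0 = quotient , factorisation
  where
  quotient : Poly
  quotient = record { coeff = Δ f ; bound = B ; vanish = Bounded-reindex suc ℕP.n≤1+n f-bounded }
  factorisation : ∀ a b → f a b ≡ umul 1 (coeff quotient) a b
  factorisation a zero    = f₀≡0 a
  factorisation a (suc b) = refl

nonzero-constant-term : ∀ {B f} → Bounded B f → ¬ UDivides f → ∃ λ a → f a 0 ≢ 0ℚ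
nonzero-constant-term f-bounded ¬u∣f = ¬∀⇒∃¬-bounded (λ a → _ ℚ.≟ 0ℚ)
  (λ {a} B≤a → f-bounded a 0 (inj₁ B≤a)) (¬u∣f ∘ UDivides-intro f-bounded)

curvePoly-bounded : ∀ Q1 Q2 Q3 →
  Bounded (suc (((2 + bound Q1) ⊔ (1 + bound Q2)) ⊔ bound Q3)) (curvePoly Q1 Q2 Q3)
curvePoly-bounded Q1 Q2 Q3 = Bounded-zmul
  (Bounded-⊕ (Bounded-⊕ (Bounded-umul 2 (vanish Q1)) (Bounded-umul 1 (vanish Q2))) (vanish Q3))

isEven : ℕ → Bool
isEven zero    = true
isEven (suc n) = not (isEven n)

isEven-2* : ∀ b → isEven (2 * b) ≡ true
isEven-2* zero    = refl
isEven-2* (suc b) = trans (cong isEven (ℕP.*-suc 2 b)) (cong (not ∘ not) (isEven-2* b))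

isEven-+-2* : ∀ m b → isEven (m + 2 * b) ≡ isEven m
isEven-+-2* zero    b = isEven-2* b
isEven-+-2* (suc m) b = cong not (isEven-+-2* m b)

parity : ∀ n → ∃ λ b → n ≡ 2 * b ⊎ n ≡ suc (2 * b)
parity zero = 0 , inj₁ refl
parity (suc n) with parity n
... | b , inj₁ refl = b , inj₂ refl
... | b , inj₂ refl = suc b , inj₁ (sym (ℕP.*-suc 2 b))

even-index : ∀ {f : Series} {a k} → (∀ a b → f a (suc (2 * b)) ≡ 0ℚ) → f a k ≢ 0ℚ → ∃ λ b → k ≡ 2 * b
even-index {a = a} {k} odd≡0 ≢0 with parity k
... | b , inj₁ k≡2b = b , k≡2b
... | b , inj₂ refl = contradiction (odd≡0 a b) ≢0

odd-index : ∀ {f : Series} {a k} → (∀ a b → f a (2 * b) ≡ 0ℚ) → f a k ≢ 0ℚ → ∃ λ b → k ≡ suc (2 * b)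
odd-index {a = a} {k} even≡0 ≢0 with parity k
... | b , inj₁ refl  = contradiction (even≡0 a b) ≢0
... | b , inj₂ k≡1+2b = b , k≡1+2b

-- Strong connectivity of graphs on ℕ

module _ {E : ℕ → ℕ → Set} (descend₂ : ∀ x → Star E (2 + x) x) where

  descend : ∀ d x → Star E (d * 2 + x) x
  descend zero    x = ε
  descend (suc d) x = descend₂ (d * 2 + x) ◅◅ descend d x

  ascend₁ : ∀ {K c} → (∀ x → E x (x + suc K)) → (∀ x → E (2 + x) (x + suc (2 * c))) →
    ∀ x → Star E x (suc x)
  ascend₁ {K} {c} up odd-jump x =
    up x ◅ subst (E (x + suc K)) (twice-up x K) (up (x + suc K)) ◅ odd-jump (x + K + K) ◅
    subst (λ y → Star E y (suc x)) (sym (back-down x K c)) (descend (K + c) (suc x))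
    where
    twice-up : ∀ x K → x + suc K + suc K ≡ 2 + (x + K + K)
    twice-up = solve-∀
    back-down : ∀ x K c → x + K + K + suc (2 * c) ≡ (K + c) * 2 + suc x
    back-down = solve-∀

  strongly-connected : (∀ x → Star E x (suc x)) → StronglyConnected E
  strongly-connected ascend i j = to-0 i ◅◅ from-0 j
    where
    to-0 : ∀ i → Star E i 0
    to-0 zero    = ε
    to-0 (suc i) = ascend (suc i) ◅◅ descend₂ i ◅◅ to-0 i
    from-0 : ∀ j → Star E 0 j
    from-0 zero    = ε
    from-0 (suc j) = from-0 j ◅◅ ascend j

-- The dependency graph

-- [z^(a+1) u^j] linPart Q1 Q2 Q3 (uPow i) is the sum of the contributions
-- of Q1, Q2, Q3 with d = 0, 1, 2.
contribution : Poly → ℕ → ℕ → ℕ → ℕ → ℚ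
contribution Q d i a j = (coeff Q ⊛ Δ^ d (uPow i)) a j

contribution-nonNeg : ∀ Q → NonNegCoeffs Q → ∀ d i a j → 0ℚ ℚ.≤ contribution Q d i a j
contribution-nonNeg Q Q≥0 d i = ⊛-nonNeg Q≥0 (λ a b → uPow-nonNeg i a (d + b))

contribution-shift : ∀ Q d i a j → contribution Q d (d + i) a j ≡ umul i (coeff Q) a j
contribution-shift Q d i a j = trans (⊛-congʳ (coeff Q) (Δ^-uPow d i) a j) (⊛-uPow (coeff Q) i a j)

coeff≡0⇒contribution≡0 : ∀ Q d i a j → (∀ {m k} → i ≡ d + m → m + k ≡ j → coeff Q a k ≡ 0ℚ) →
  contribution Q d i a j ≡ 0ℚ
coeff≡0⇒contribution≡0 Q d i a j coeff≡0 with d ≤? i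
... | yes d≤i = begin
  contribution Q d i a j       ≡⟨ cong (λ n → contribution Q d n a j) i≡d+m ⟩
  contribution Q d (d + m) a j ≡⟨ contribution-shift Q d m a j ⟩
  umul m (coeff Q) a j         ≡⟨ umul-vanishes (coeff Q) a (coeff≡0 i≡d+m) ⟩
  0ℚ                           ∎
  where
  m : ℕ
  m = i ∸ d
  i≡d+m : i ≡ d + m
  i≡d+m = sym (ℕP.m+[n∸m]≡n d≤i)
... | no d≰i = ⊛-zeroʳ (coeff Q) (Δ^-uPow-< (ℕP.≰⇒> d≰i)) a j

contribution≡0⇒coeff≡0 : ∀ Q d {i a k j} → contribution Q d (d + i) a j ≡ 0ℚ → i + k ≡ j →
  coeff Q a k ≡ 0ℚ
contribution≡0⇒coeff≡0 Q d {i} {a} {k} {j} contribution≡0 i+k≡j = begin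
  coeff Q a k                  ≡⟨ umul-hit (coeff Q) a i+k≡j ⟨
  umul i (coeff Q) a j         ≡⟨ contribution-shift Q d i a j ⟨
  contribution Q d (d + i) a j ≡⟨ contribution≡0 ⟩
  0ℚ                           ∎

module Dependencies (Q1 Q2 Q3 : Poly) where

  independent : ∀ {i j} →
    (∀ a → contribution Q1 0 i a j ≡ 0ℚ × contribution Q2 1 i a j ≡ 0ℚ × contribution Q3 2 i a j ≡ 0ℚ) →
    ¬ DepEdge Q1 Q2 Q3 i j
  independent contributions≡0 edge = edge λ
    { zero    → refl
    ; (suc a) → let c₁ , c₂ , c₃ = contributions≡0 a in cong₂ ℚ._+_ c₁ (cong₂ ℚ._+_ c₂ c₃)
    }

  record EdgeClosed (P : ℕ → Set) : Set where
    field
      closed₁ : ∀ {i a k} → P i → coeff Q1 a k ≢ 0ℚ → P (i + k)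
      closed₂ : ∀ {i a k} → P (1 + i) → coeff Q2 a k ≢ 0ℚ → P (i + k)
      closed₃ : ∀ {i a k} → P (2 + i) → coeff Q3 a k ≢ 0ℚ → P (i + k)

  DepEdge-preserves : ∀ {P} → Decidable P → EdgeClosed P → ∀ {i j} → DepEdge Q1 Q2 Q3 i j → P i → P j
  DepEdge-preserves {P} P? closure {i} {j} edge Pi with P? j
  ... | yes Pj  = Pj
  ... | no  ¬Pj = contradiction edge
    (independent λ a → forced Q1 0 closed₁ a , forced Q2 1 closed₂ a , forced Q3 2 closed₃ a)
    where
    open EdgeClosed closure
    forced : ∀ Q d → (∀ {m a k} → P (d + m) → coeff Q a k ≢ 0ℚ → P (m + k)) →
      ∀ a → contribution Q d i a j ≡ 0ℚ
    forced Q d closed a = coeff≡0⇒contribution≡0 Q d i a j λ {m} {k} i≡d+m m+k≡j →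
      decidable-stable (coeff Q a k ℚ.≟ 0ℚ) λ ≢0 → ¬Pj (subst P m+k≡j (closed (subst P i≡d+m Pi) ≢0))

  Star-preserves : ∀ {P} → Decidable P → EdgeClosed P → ∀ {i j} → Star (DepEdge Q1 Q2 Q3) i j → P i → P j
  Star-preserves {P} P? closure =
    fold (λ i j → P i → P j) (λ edge Pj⇒Pk → Pj⇒Pk ∘ DepEdge-preserves P? closure edge) (λ Pi → Pi)

  IsZero-∂uQ1⇒0↛1 : IsZero (∂u (coeff Q1)) → ¬ Star (DepEdge Q1 Q2 Q3) 0 1
  IsZero-∂uQ1⇒0↛1 ∂uQ1≡0 path = contradiction (Star-preserves (_≟ 0) closure path refl) λ ()
    where
    ΔQ1≡0 : IsZero (Δ (coeff Q1))
    ΔQ1≡0 = Equivalence.to (IsZero-∂u⇔IsZero-Δ {coeff Q1}) ∂uQ1≡0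
    closed₁ : ∀ {i a k} → i ≡ 0 → coeff Q1 a k ≢ 0ℚ → i + k ≡ 0
    closed₁ {k = zero}          i≡0 _  = trans (ℕP.+-identityʳ _) i≡0
    closed₁ {a = a} {k = suc k} _   ≢0 = contradiction (ΔQ1≡0 a k) ≢0
    closure : EdgeClosed (_≡ 0)
    closure = record { closed₁ = closed₁ ; closed₂ = λ () ; closed₃ = λ () }

  module NonNegative (Q1≥0 : NonNegCoeffs Q1) (Q2≥0 : NonNegCoeffs Q2) (Q3≥0 : NonNegCoeffs Q3) where

    contributions≡0 : ∀ {i j} → (∀ a → linPart Q1 Q2 Q3 (uPow i) a j ≡ 0ℚ) →
      ∀ a → contribution Q1 0 i a j ≡ 0ℚ × contribution Q2 1 i a j ≡ 0ℚ × contribution Q3 2 i a j ≡ 0ℚ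
    contributions≡0 {i} {j} linPart≡0 a =
      let c₁≡0 , c₂+c₃≡0 = nonNeg-+-≡0 (contribution-nonNeg Q1 Q1≥0 0 i a j)
                              (+-nonNeg c₂≥0 c₃≥0) (linPart≡0 (suc a))
      in c₁≡0 , nonNeg-+-≡0 c₂≥0 c₃≥0 c₂+c₃≡0
      where
      c₂≥0 : 0ℚ ℚ.≤ contribution Q2 1 i a j
      c₂≥0 = contribution-nonNeg Q2 Q2≥0 1 i a j
      c₃≥0 : 0ℚ ℚ.≤ contribution Q3 2 i a j
      c₃≥0 = contribution-nonNeg Q3 Q3≥0 2 i a j

    DepEdge-Q1 : ∀ {i a k j} → coeff Q1 a k ≢ 0ℚ → i + k ≡ j → DepEdge Q1 Q2 Q3 i j
    DepEdge-Q1 {a = a} ≢0 i+k≡j linPart≡0 =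
      ≢0 (contribution≡0⇒coeff≡0 Q1 0 (proj₁ (contributions≡0 linPart≡0 a)) i+k≡j)

    DepEdge-Q2 : ∀ {i a k j} → coeff Q2 a k ≢ 0ℚ → i + k ≡ j → DepEdge Q1 Q2 Q3 (1 + i) j
    DepEdge-Q2 {a = a} ≢0 i+k≡j linPart≡0 =
      ≢0 (contribution≡0⇒coeff≡0 Q2 1 (proj₁ (proj₂ (contributions≡0 linPart≡0 a))) i+k≡j)

    DepEdge-Q3 : ∀ {i a k j} → coeff Q3 a k ≢ 0ℚ → i + k ≡ j → DepEdge Q1 Q2 Q3 (2 + i) j
    DepEdge-Q3 {a = a} ≢0 i+k≡j linPart≡0 =
      ≢0 (contribution≡0⇒coeff≡0 Q3 2 (proj₂ (proj₂ (contributions≡0 linPart≡0 a))) i+k≡j)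

    EvenInU-curvePoly⇒ : EvenInU (curvePoly Q1 Q2 Q3) →
      (∀ a b → coeff Q1 a (suc (2 * b)) ≡ 0ℚ) × (∀ a b → coeff Q2 a (2 * b) ≡ 0ℚ) ×
      (∀ a b → coeff Q3 a (suc (2 * b)) ≡ 0ℚ)
    EvenInU-curvePoly⇒ curve-even =
      (λ a b → trans (sym (umul-hit {2} (coeff Q1) a (cong suc (sym (ℕP.*-suc 2 b)))))
                     (proj₁ (terms≡0 a (suc b))))
      , (λ a b → proj₁ (proj₂ (terms≡0 a b)))
      , (λ a b → proj₂ (proj₂ (terms≡0 a b)))
      where
      terms≡0 : ∀ a b → umul 2 (coeff Q1) a (suc (2 * b)) ≡ 0ℚ × coeff Q2 a (2 * b) ≡ 0ℚ ×
        coeff Q3 a (suc (2 * b)) ≡ 0ℚ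
      terms≡0 a b =
        let u²Q1+uQ2≡0 , Q3≡0 = nonNeg-+-≡0 (+-nonNeg u²Q1≥0 (Q2≥0 a _)) (Q3≥0 a _) (curve-even (suc a) b)
            u²Q1≡0 , Q2≡0 = nonNeg-+-≡0 u²Q1≥0 (Q2≥0 a _) u²Q1+uQ2≡0
        in u²Q1≡0 , Q2≡0 , Q3≡0
        where
        u²Q1≥0 : 0ℚ ℚ.≤ umul 2 (coeff Q1) a (suc (2 * b))
        u²Q1≥0 = umul-nonNeg 2 Q1≥0 a (suc (2 * b))

    EvenInU⇒0↛1 : EvenInU (curvePoly Q1 Q2 Q3) → ¬ Star (DepEdge Q1 Q2 Q3) 0 1
    EvenInU⇒0↛1 curve-even path =
      contradiction (Star-preserves (λ j → isEven j Bool.≟ true) closure path refl) λ ()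
      where
      Q1-odd≡0 : ∀ a b → coeff Q1 a (suc (2 * b)) ≡ 0ℚ
      Q1-odd≡0 = proj₁ (EvenInU-curvePoly⇒ curve-even)
      Q2-even≡0 : ∀ a b → coeff Q2 a (2 * b) ≡ 0ℚ
      Q2-even≡0 = proj₁ (proj₂ (EvenInU-curvePoly⇒ curve-even))
      Q3-odd≡0 : ∀ a b → coeff Q3 a (suc (2 * b)) ≡ 0ℚ
      Q3-odd≡0 = proj₂ (proj₂ (EvenInU-curvePoly⇒ curve-even))
      closed₁ : ∀ {i a k} → isEven i ≡ true → coeff Q1 a k ≢ 0ℚ → isEven (i + k) ≡ true
      closed₁ {i} i-even ≢0 with even-index {coeff Q1} Q1-odd≡0 ≢0
      ... | b , refl = trans (isEven-+-2* i b) i-even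
      closed₂ : ∀ {i a k} → isEven (1 + i) ≡ true → coeff Q2 a k ≢ 0ℚ → isEven (i + k) ≡ true
      closed₂ {i} 1+i-even ≢0 with odd-index {coeff Q2} Q2-even≡0 ≢0
      ... | b , refl = trans (cong isEven (ℕP.+-suc i (2 * b))) (trans (isEven-+-2* (suc i) b) 1+i-even)
      closed₃ : ∀ {i a k} → isEven (2 + i) ≡ true → coeff Q3 a k ≢ 0ℚ → isEven (i + k) ≡ true
      closed₃ {i} 2+i-even ≢0 with even-index {coeff Q3} Q3-odd≡0 ≢0
      ... | b , refl = trans (isEven-+-2* i b) (trans (sym (not-involutive (isEven i))) 2+i-even)
      closure : EdgeClosed (λ j → isEven j ≡ true)
      closure = record { closed₁ = λ {i} → closed₁ {i} ; closed₂ = λ {i} → closed₂ {i} ; closed₃ = λ {i} → closed₃ {i} }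

    UDivides⇒1↛0 : UDivides (coeff Q2 ⊕ coeff Q3) → ¬ Star (DepEdge Q1 Q2 Q3) 1 0
    UDivides⇒1↛0 (_ , u∣Q2+Q3) path = contradiction (Star-preserves (0 <?_) closure path z<s) λ ()
      where
      constant-terms≡0 : ∀ a → coeff Q2 a 0 ≡ 0ℚ × coeff Q3 a 0 ≡ 0ℚ
      constant-terms≡0 a = nonNeg-+-≡0 (Q2≥0 a 0) (Q3≥0 a 0) (u∣Q2+Q3 a 0)
      positive-shift : ∀ {f : Series} {i a k} → (∀ a → f a 0 ≡ 0ℚ) → f a k ≢ 0ℚ → 0 < i + k
      positive-shift {a = a} {k = zero}  f₀≡0 ≢0 = contradiction (f₀≡0 a) ≢0
      positive-shift {i = i} {k = suc k} _   _  = ℕP.<-≤-trans z<s (ℕP.m≤n+m (suc k) i)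
      closure : EdgeClosed (0 <_)
      closure = record
        { closed₁ = λ {i} {a} {k} 0<i _ → ℕP.<-≤-trans 0<i (ℕP.m≤m+n i k)
        ; closed₂ = λ _ → positive-shift {coeff Q2} (proj₁ ∘ constant-terms≡0)
        ; closed₃ = λ _ → positive-shift {coeff Q3} (proj₂ ∘ constant-terms≡0)
        }

    ascending-edge : ¬ IsZero (∂u (coeff Q1)) → ∃ λ K → ∀ i → DepEdge Q1 Q2 Q3 i (i + suc K)
    ascending-edge ∂uQ1≢0 =
      let _ , K , ≢0 = nonzero-coefficient (Bounded-reindex suc ℕP.n≤1+n (vanish Q1))
                         (∂uQ1≢0 ∘ Equivalence.from (IsZero-∂u⇔IsZero-Δ {coeff Q1}))
      in K , λ i → DepEdge-Q1 ≢0 refl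

    odd-edge : ¬ EvenInU (curvePoly Q1 Q2 Q3) → ∃ λ b → ∀ i → DepEdge Q1 Q2 Q3 (2 + i) (i + suc (2 * b))
    odd-edge curve-odd with nonzero-coefficient
      (Bounded-reindex (λ b → suc (2 * b)) (λ b → ℕP.m≤n⇒m≤1+n (ℕP.m≤m+n b (b + 0))) (curvePoly-bounded Q1 Q2 Q3)) curve-odd
    ... | zero , _ , ≢0 = contradiction refl ≢0
    ... | suc a , b , ≢0 with coeff Q3 a (suc (2 * b)) ℚ.≟ 0ℚ | coeff Q2 a (2 * b) ℚ.≟ 0ℚ
    ...   | no Q3≢0 | _       = b , λ i → DepEdge-Q3 Q3≢0 refl
    ...   | yes _   | no Q2≢0 = b , λ i → DepEdge-Q2 Q2≢0 (sym (ℕP.+-suc i (2 * b)))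
    ...   | yes Q3≡0 | yes Q2≡0 =
      let k , 2+k≡1+2b , Q1≢0 = umul-nonzero {2} (coeff Q1) a λ u²Q1≡0 →
                                  ≢0 (cong₂ ℚ._+_ (cong₂ ℚ._+_ u²Q1≡0 Q2≡0) Q3≡0)
      in b , λ i → DepEdge-Q1 Q1≢0 (begin
        2 + i + k   ≡⟨ cong (_+ k) (ℕP.+-comm 2 i) ⟩
        i + 2 + k   ≡⟨ ℕP.+-assoc i 2 k ⟩
        i + (2 + k) ≡⟨ cong (i +_) 2+k≡1+2b ⟩
        i + suc (2 * b) ∎)

    descending-path : ¬ UDivides (coeff Q2 ⊕ coeff Q3) → ∀ i → Star (DepEdge Q1 Q2 Q3) (2 + i) i
    descending-path ¬u∣Q2+Q3 with nonzero-constant-term (Bounded-⊕ (vanish Q2) (vanish Q3)) ¬u∣Q2+Q3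
    ... | a , ≢0 with coeff Q2 a 0 ℚ.≟ 0ℚ
    ...   | no Q2≢0 = λ i →
      DepEdge-Q2 Q2≢0 (ℕP.+-identityʳ (suc i)) ◅ DepEdge-Q2 Q2≢0 (ℕP.+-identityʳ i) ◅ ε
    ...   | yes Q2≡0 = λ i →
      DepEdge-Q3 (λ Q3≡0 → ≢0 (cong₂ ℚ._+_ Q2≡0 Q3≡0)) (ℕP.+-identityʳ i) ◅ ε

proposition1 : (Q0 Q1 Q2 Q3 : Poly) →
    NonNegCoeffs Q0 → NonNegCoeffs Q1 → NonNegCoeffs Q2 → NonNegCoeffs Q3 →
    StronglyConnected (DepEdge Q1 Q2 Q3)
      ⇔ ((¬ IsZero (∂u (coeff Q1)))
         × (¬ EvenInU (curvePoly Q1 Q2 Q3))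
         × (¬ UDivides (coeff Q2 ⊕ coeff Q3)))
-- Q0 only enters the inhomogeneous part of the equation, which creates no dependencies.
proposition1 _ Q1 Q2 Q3 _ Q1≥0 Q2≥0 Q3≥0 = mk⇔ necessary sufficient
  where
  open Dependencies Q1 Q2 Q3
  open NonNegative Q1≥0 Q2≥0 Q3≥0
  conditions : Set
  conditions = (¬ IsZero (∂u (coeff Q1))) × (¬ EvenInU (curvePoly Q1 Q2 Q3)) ×
               (¬ UDivides (coeff Q2 ⊕ coeff Q3))
  necessary : StronglyConnected (DepEdge Q1 Q2 Q3) → conditions
  necessary connected =
      (λ ∂uQ1≡0 → IsZero-∂uQ1⇒0↛1 ∂uQ1≡0 (connected 0 1))
    , (λ curve-even → EvenInU⇒0↛1 curve-even (connected 0 1))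
    , (λ u∣Q2+Q3 → UDivides⇒1↛0 u∣Q2+Q3 (connected 1 0))
  sufficient : conditions → StronglyConnected (DepEdge Q1 Q2 Q3)
  sufficient (∂uQ1≢0 , curve-odd , ¬u∣Q2+Q3) =
    let K , up       = ascending-edge ∂uQ1≢0
        c , odd-jump = odd-edge curve-odd
        down         = descending-path ¬u∣Q2+Q3
    in strongly-connected down (ascend₁ down {K} {c} up odd-jump)
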